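{- For any two graphs $G_1$ and $G_2$, $\mathcal{A}(G_1+G_2)=\mathcal{A}(G_1)+\mathcal{A}(G_2)$.
   Context: All graphs are finite, simple, undirected and nonempty. A coloring of a graph $G$ assigns colors to its vertices so that adjacent vertices receive different colors; two colorings are equivalent if they induce the same partition of the vertex set into color classes. $S(G,k)$ denotes the number of non-equivalent colorings of $G$ using exactly $k$ colors. Set $\mathcal{B}(G)=\sum_{k\ge1}S(G,k)$, $\mathcal{T}(G)=\sum_{k\ge1}kS(G,k)$ and $\mathcal{A}(G)=\mathcal{T}(G)/\mathcal{B}(G)$. The join $G_1+G_2$ is obtained from the disjoint union of $G_1$ and $G_2$ by adding all edges between a vertex of $G_1$ and a vertex of $G_2$. -}

module Defs where

open import Data.Bool using (Bool; true; false; _∧_; _∨_; not; if_then_else_)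
open import Data.Nat using (ℕ; zero; suc; _+_; _*_; _<_; _≡ᵇ_; NonZero)
open import Data.Nat.Properties using (<-≤-trans; m≤m+n)
open import Data.Fin using (Fin; splitAt)
open import Data.Vec using (Vec; []; _∷_; lookup)
open import Data.List using (List; []; _∷_; [_]; map; concatMap; upTo; length; filterᵇ; sum; allFin)
open import Data.Bool.ListAction using (and)
open import Data.Product using (_×_; _,_; proj₁; proj₂)
open import Data.Sum using (_⊎_; inj₁; inj₂)
open import Data.Integer using (+_)
open import Data.Rational using (ℚ; _/_; 0ℚ)
open import Relation.Binary.PropositionalEquality using (_≡_; refl)

record Graph : Set where
  field
    n        : ℕ
    nonempty : 0 < n
    adj      : Fin n → Fin n → Bool
    sym      : ∀ i j → adj i j ≡ adj j i
    irrefl   : ∀ i → adj i i ≡ false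
open Graph public

joinAdj : ∀ {n₁ n₂} → (Fin n₁ → Fin n₁ → Bool) → (Fin n₂ → Fin n₂ → Bool)
        → Fin (n₁ + n₂) → Fin (n₁ + n₂) → Bool
joinAdj {n₁} a₁ a₂ i j with splitAt n₁ i | splitAt n₁ j
... | inj₁ x | inj₁ y = a₁ x y
... | inj₂ x | inj₂ y = a₂ x y
... | inj₁ _ | inj₂ _ = true
... | inj₂ _ | inj₁ _ = true

joinSym : ∀ {n₁ n₂} (a₁ : Fin n₁ → Fin n₁ → Bool) (a₂ : Fin n₂ → Fin n₂ → Bool)
        → (∀ i j → a₁ i j ≡ a₁ j i) → (∀ i j → a₂ i j ≡ a₂ j i)
        → ∀ i j → joinAdj a₁ a₂ i j ≡ joinAdj a₁ a₂ j i
joinSym {n₁} a₁ a₂ s₁ s₂ i j with splitAt n₁ i | splitAt n₁ j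
... | inj₁ x | inj₁ y = s₁ x y
... | inj₂ x | inj₂ y = s₂ x y
... | inj₁ _ | inj₂ _ = refl
... | inj₂ _ | inj₁ _ = refl

joinIrrefl : ∀ {n₁ n₂} (a₁ : Fin n₁ → Fin n₁ → Bool) (a₂ : Fin n₂ → Fin n₂ → Bool)
           → (∀ i → a₁ i i ≡ false) → (∀ i → a₂ i i ≡ false)
           → ∀ i → joinAdj a₁ a₂ i i ≡ false
joinIrrefl {n₁} a₁ a₂ r₁ r₂ i with splitAt n₁ i
... | inj₁ x = r₁ x
... | inj₂ x = r₂ x

_⊕_ : Graph → Graph → Graph
G₁ ⊕ G₂ = record
  { n        = n G₁ + n G₂
  ; nonempty = <-≤-trans (nonempty G₁) (m≤m+n (n G₁) (n G₂))
  ; adj      = joinAdj (adj G₁) (adj G₂)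
  ; sym      = joinSym (adj G₁) (adj G₂) (sym G₁) (sym G₂)
  ; irrefl   = joinIrrefl (adj G₁) (adj G₂) (irrefl G₁) (irrefl G₂)
  }

-- Partitions of Fin n are enumerated via their canonical labelling (restricted growth
-- strings): block labels 0,1,2,… are assigned in order of first appearance, so each
-- partition of the vertex set occurs exactly once.  `rgs n m` lists all such strings of
-- length n when m labels are already in use, together with the final number of blocks.
rgs : (n : ℕ) → ℕ → List (Vec ℕ n × ℕ)
rgs zero    m = [ ([] , m) ]
rgs (suc n) m =
  concatMap (λ c → map (λ p → (c ∷ proj₁ p , proj₂ p))
                       (rgs n (if c ≡ᵇ m then suc m else m)))
            (upTo (suc m))

partitions : (n : ℕ) → List (Vec ℕ n × ℕ)
partitions n = rgs n 0

-- A partition is a (non-equivalent) coloring iff every block is independent.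
isProper : (G : Graph) → Vec ℕ (n G) → Bool
isProper G v =
  and (concatMap (λ i → map (λ j → not (adj G i j) ∨ not (lookup v i ≡ᵇ lookup v j))
                            (allFin (n G)))
                 (allFin (n G)))

S : Graph → ℕ → ℕ
S G k = length (filterᵇ (λ p → isProper G (proj₁ p) ∧ (proj₂ p ≡ᵇ k)) (partitions (n G)))

-- Σ_{k=1}^{n} f k   (S(G,k) = 0 for k > |V(G)|, so this is the full sum over k ≥ 1)
sumTo : ℕ → (ℕ → ℕ) → ℕ
sumTo zero    f = 0
sumTo (suc m) f = sumTo m f + f (suc m)

𝓑 : Graph → ℕ
𝓑 G = sumTo (n G) (S G)

𝓣 : Graph → ℕ
𝓣 G = sumTo (n G) (λ k → k * S G k)

-- t / b as a rational; the b = 0 branch is never used since 𝓑 G ≥ 1.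
ratio : ℕ → ℕ → ℚ
ratio t zero    = 0ℚ
ratio t (suc b) = (+ t) / suc b

𝓐 : Graph → ℚ
𝓐 G = ratio (𝓣 G) (𝓑 G)

{-# OPTIONS --safe #-}
-- Partitions are enumerated by restricted growth strings, so a partition of the vertices of
-- G₁ + G₂ is a string v₁ for G₁ (with k₁ blocks) followed by a string v₂ for G₂. Since every
-- label below k₁ occurs in v₁ and every vertex of G₁ is adjacent to every vertex of G₂, it is
-- a colouring iff v₁ and v₂ are colourings and all labels of v₂ are ≥ k₁; such v₂ are exactly
-- the shifts by k₁ of the strings for G₂. Hence the sum of h(k) over colourings with k colours
-- is, for G₁ + G₂, the sum of h(k₁ + k₂) over pairs of colourings of G₁ and G₂. Taking h = 1
-- and h = id gives 𝓑(G₁ + G₂) = 𝓑₁𝓑₂ and 𝓣(G₁ + G₂) = 𝓣₁𝓑₂ + 𝓑₁𝓣₂, and dividing the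
-- second by the first gives the theorem.
module Submission where

open import Data.Bool using (Bool; true; false; T; not; _∧_; _∨_; if_then_else_)
open import Data.Bool.ListAction using (and)
open import Data.Bool.Properties using (T-∧; T-≡)
open import Data.Empty using (⊥-elim)
open import Data.Fin using (Fin; toℕ; splitAt; _↑ˡ_; _↑ʳ_)
open import Data.Fin.Properties using (toℕ-injective; splitAt-↑ˡ; splitAt-↑ʳ)
import Data.Integer as ℤ
open import Data.Integer.Properties using (pos-+; pos-*)
open import Data.List as List
  using (List; []; _∷_; concatMap; applyUpTo; upTo; allFin; length; filterᵇ)
  renaming (_++_ to _++ˡ_)
open import Data.List.Membership.Propositional using (_∈_)
open import Data.List.Membership.Propositional.Properties
  using (∈-allFin; ∈-map⁺; ∈-concatMap⁺; ∈-upTo⁺)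
open import Data.List.Properties using (map-cong; map-++; map-∘; map-upTo; concatMap-cong)
open import Data.List.Relation.Unary.All as All using (All; []; _∷_)
open import Data.List.Relation.Unary.All.Properties
  using (map⁺; map⁻; concat⁺; concat⁻; applyUpTo⁺₁)
open import Data.List.Relation.Unary.Any as Any using (here; there)
open import Data.Nat using (ℕ; zero; suc; _+_; _*_; _≤_; _<_; _≡ᵇ_; z≤n; s≤s)
open import Data.Nat.ListAction using (sum)
open import Data.Nat.ListAction.Properties using (sum-++)
open import Data.Nat.Properties
open import Algebra.Properties.CommutativeSemigroup +-commutativeSemigroup using ()
  renaming (interchange to +-interchange)
open import Algebra.Properties.CommutativeSemigroup *-commutativeSemigroup using ()
  renaming (x∙yz≈y∙zx to *-rotate)
open import Data.Product using (_×_; _,_; proj₁; proj₂; ∃-syntax; uncurry)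
open import Data.Rational as ℚ using (toℚᵘ; fromℚᵘ)
open import Data.Rational.Properties
  using (fromℚᵘ-toℚᵘ; fromℚᵘ-cong; toℚᵘ-homo-+; toℚᵘ-fromℚᵘ; /-cong)
open import Data.Rational.Unnormalised as ℚᵘ using (mkℚᵘ)
import Data.Rational.Unnormalised.Properties as ℚᵘ
open import Data.Sum using (inj₁; inj₂)
open import Data.Vec as Vec using (Vec; []; _∷_; lookup; _++_)
open import Data.Vec.Properties using (lookup-map; lookup-++ˡ; lookup-++ʳ; lookup-splitAt)
import Data.Vec.Relation.Unary.All as VecAll
open import Data.Vec.Relation.Unary.All.Properties using (lookup⁺; lookup⁻)
open import Function using (_∘_; id; _⇔_; mk⇔; Equivalence)
open import Relation.Binary.PropositionalEquality
open import Relation.Nullary using (¬_; yes; no; does)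
open import Relation.Nullary.Decidable using (dec-true; dec-false; does-⇔; T?; _×-dec_)

open import Defs hiding (sym)

open Equivalence using (to; from)

private
  variable
    A B : Set

-- Finite sums

∑ : List A → (A → ℕ) → ℕ
∑ xs f = sum (List.map f xs)

-- Between _+_ and _*_: the summand of ∑[ x ∈ xs ] a * f x + b is a * f x.
infix 6.5 ∑
syntax ∑ xs (λ x → e) = ∑[ x ∈ xs ] e

∑-cong : ∀ (xs : List A) {f g : A → ℕ} → (∀ x → f x ≡ g x) → ∑ xs f ≡ ∑ xs g
∑-cong xs f≗g = cong sum (map-cong f≗g xs)

∑-congᴬ : ∀ {xs : List A} {f g : A → ℕ} → All (λ x → f x ≡ g x) xs → ∑ xs f ≡ ∑ xs g
∑-congᴬ []         = refl
∑-congᴬ (eq ∷ eqs) = cong₂ _+_ eq (∑-congᴬ eqs)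

∑-zero : ∀ {xs : List A} {f : A → ℕ} → All (λ x → f x ≡ 0) xs → ∑ xs f ≡ 0
∑-zero []         = refl
∑-zero (eq ∷ eqs) = cong₂ _+_ eq (∑-zero eqs)

∑-++ : ∀ (xs ys : List A) (f : A → ℕ) → ∑ (xs ++ˡ ys) f ≡ ∑ xs f + ∑ ys f
∑-++ xs ys f = trans (cong sum (map-++ f xs ys)) (sum-++ (List.map f xs) (List.map f ys))

∑-map : ∀ (g : A → B) (f : B → ℕ) (xs : List A) → ∑ (List.map g xs) f ≡ ∑ xs (f ∘ g)
∑-map g f xs = cong sum (sym (map-∘ xs))

∑-concatMap : ∀ (g : A → List B) (f : B → ℕ) (xs : List A) →
              ∑ (concatMap g xs) f ≡ ∑[ x ∈ xs ] ∑ (g x) f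
∑-concatMap g f []       = refl
∑-concatMap g f (x ∷ xs) =
  trans (∑-++ (g x) (concatMap g xs) f) (cong (∑ (g x) f +_) (∑-concatMap g f xs))

∑-+ : ∀ (f g : A → ℕ) (xs : List A) → ∑[ x ∈ xs ] (f x + g x) ≡ ∑ xs f + ∑ xs g
∑-+ f g []       = refl
∑-+ f g (x ∷ xs) = trans (cong (f x + g x +_) (∑-+ f g xs)) (+-interchange (f x) (g x) _ _)

∑-*ˡ : ∀ a (f : A → ℕ) (xs : List A) → ∑[ x ∈ xs ] a * f x ≡ a * ∑ xs f
∑-*ˡ a f []       = sym (*-zeroʳ a)
∑-*ˡ a f (x ∷ xs) = trans (cong (a * f x +_) (∑-*ˡ a f xs)) (sym (*-distribˡ-+ a (f x) _))

∑-*ʳ : ∀ a (f : A → ℕ) (xs : List A) → ∑[ x ∈ xs ] f x * a ≡ ∑ xs f * a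
∑-*ʳ a f []       = refl
∑-*ʳ a f (x ∷ xs) = trans (cong (f x * a +_) (∑-*ʳ a f xs)) (sym (*-distribʳ-+ a (f x) _))

∈⇒≤∑ : ∀ {x} {xs : List A} (f : A → ℕ) → x ∈ xs → f x ≤ ∑ xs f
∈⇒≤∑ f (here refl)             = m≤m+n _ _
∈⇒≤∑ {xs = y ∷ _} f (there x∈) = ≤-trans (∈⇒≤∑ f x∈) (m≤n+m _ (f y))

applyUpTo-+ : ∀ (g : ℕ → A) m n →
              applyUpTo g (m + n) ≡ applyUpTo g m ++ˡ applyUpTo (g ∘ (m +_)) n
applyUpTo-+ g zero    n = refl
applyUpTo-+ g (suc m) n = cong (g 0 ∷_) (applyUpTo-+ (g ∘ suc) m n)

∑-upTo-+ : ∀ m n (f : ℕ → ℕ) → ∑ (upTo (m + n)) f ≡ ∑ (upTo m) f + ∑[ c ∈ upTo n ] f (m + c)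
∑-upTo-+ m n f = begin
  ∑ (upTo (m + n)) f
    ≡⟨ cong (λ cs → ∑ cs f) (applyUpTo-+ id m n) ⟩
  ∑ (upTo m ++ˡ applyUpTo (m +_) n) f
    ≡⟨ ∑-++ (upTo m) _ f ⟩
  ∑ (upTo m) f + ∑ (applyUpTo (m +_) n) f
    ≡⟨ cong (λ cs → ∑ (upTo m) f + ∑ cs f) (map-upTo (m +_) n) ⟨
  ∑ (upTo m) f + ∑ (List.map (m +_) (upTo n)) f
    ≡⟨ cong (∑ (upTo m) f +_) (∑-map (m +_) f (upTo n)) ⟩
  ∑ (upTo m) f + ∑[ c ∈ upTo n ] f (m + c) ∎
  where open ≡-Reasoning

𝟙 : Bool → ℕ
𝟙 true  = 1
𝟙 false = 0

𝟙-∧ : ∀ a b → 𝟙 (a ∧ b) ≡ 𝟙 a * 𝟙 b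
𝟙-∧ true  b = sym (+-identityʳ (𝟙 b))
𝟙-∧ false b = refl

length-filterᵇ : ∀ (q : A → Bool) (xs : List A) → length (filterᵇ q xs) ≡ ∑[ x ∈ xs ] 𝟙 (q x)
length-filterᵇ q []       = refl
length-filterᵇ q (x ∷ xs) with q x
... | true  = cong suc (length-filterᵇ q xs)
... | false = length-filterᵇ q xs

T-and : ∀ bs → T (and bs) ⇔ All T bs
T-and []       = mk⇔ (λ _ → []) (λ _ → _)
T-and (b ∷ bs) = mk⇔
  (λ t → let tb , tbs = to (T-∧ {b}) t in tb ∷ to (T-and bs) tbs)
  (λ { (tb ∷ tbs) → from (T-∧ {b}) (tb , from (T-and bs) tbs) })

T-not∨not : ∀ a b → T (not a ∨ not b) ⇔ (T a → ¬ T b)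
T-not∨not true  true  = mk⇔ (λ ()) (λ h → h _ _)
T-not∨not true  false = mk⇔ (λ _ _ ()) (λ _ → _)
T-not∨not false b     = mk⇔ (λ _ ()) (λ _ → _)

+-cancelˡ-≡ᵇ : ∀ b x y → (b + x ≡ᵇ b + y) ≡ (x ≡ᵇ y)
+-cancelˡ-≡ᵇ zero    x y = refl
+-cancelˡ-≡ᵇ (suc b) x y = +-cancelˡ-≡ᵇ b x y

sumTo-cong : ∀ N {f g : ℕ → ℕ} → (∀ k → f k ≡ g k) → sumTo N f ≡ sumTo N g
sumTo-cong zero    f≗g = refl
sumTo-cong (suc N) f≗g = cong₂ _+_ (sumTo-cong N f≗g) (f≗g (suc N))

sumTo-*ˡ : ∀ a N (f : ℕ → ℕ) → sumTo N (λ k → a * f k) ≡ a * sumTo N f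
sumTo-*ˡ a zero    f = sym (*-zeroʳ a)
sumTo-*ˡ a (suc N) f =
  trans (cong (_+ a * f (suc N)) (sumTo-*ˡ a N f)) (sym (*-distribˡ-+ a _ _))

sumTo-∑ : ∀ N (g : ℕ → A → ℕ) (xs : List A) →
          sumTo N (λ k → ∑ xs (g k)) ≡ ∑[ x ∈ xs ] sumTo N (λ k → g k x)
sumTo-∑ zero    g xs = sym (∑-zero (All.universal (λ _ → refl) xs))
sumTo-∑ (suc N) g xs = trans (cong (_+ ∑ xs (g (suc N))) (sumTo-∑ N g xs))
                             (sym (∑-+ (λ x → sumTo N (λ k → g k x)) (g (suc N)) xs))

sumTo-𝟙≡ᵇ-beyond : ∀ N {j} (f : ℕ → ℕ) → N < j → sumTo N (λ k → 𝟙 (j ≡ᵇ k) * f k) ≡ 0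
sumTo-𝟙≡ᵇ-beyond zero        f _   = refl
sumTo-𝟙≡ᵇ-beyond (suc N) {j} f N<j =
  cong₂ _+_ (sumTo-𝟙≡ᵇ-beyond N f (<-trans (n<1+n N) N<j))
            (cong (λ b → 𝟙 b * f (suc N)) (dec-false (j ≟ suc N) (>⇒≢ N<j)))

sumTo-𝟙≡ᵇ : ∀ N {j} (f : ℕ → ℕ) → 0 < j → j ≤ N → sumTo N (λ k → 𝟙 (j ≡ᵇ k) * f k) ≡ f j
sumTo-𝟙≡ᵇ zero        f 0<j j≤0 = ⊥-elim (<⇒≱ 0<j j≤0)
sumTo-𝟙≡ᵇ (suc N) {j} f 0<j j≤1+N with j ≟ suc N
... | yes refl = trans (cong₂ _+_ (sumTo-𝟙≡ᵇ-beyond N f (n<1+n N))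
                                  (cong (λ b → 𝟙 b * f j) (dec-true (j ≟ j) refl)))
                       (+-identityʳ (f j))
... | no  j≢   = trans (cong₂ _+_ (sumTo-𝟙≡ᵇ N f 0<j (≤-pred (≤∧≢⇒< j≤1+N j≢)))
                                  (cong (λ b → 𝟙 b * f (suc N)) (dec-false (j ≟ suc N) j≢)))
                       (+-identityʳ (f j))

-- Restricted growth strings

next : ℕ → ℕ → ℕ
next c m = if c ≡ᵇ m then suc m else m

next-≡ : ∀ m → next m m ≡ suc m
next-≡ m = cong (if_then suc m else m) (dec-true (m ≟ m) refl)

next-≢ : ∀ {c m} → c ≢ m → next c m ≡ m
next-≢ {c} {m} c≢m = cong (if_then suc m else m) (dec-false (c ≟ m) c≢m)

next-+ : ∀ b c j → next (b + c) (b + j) ≡ b + next c j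
next-+ b c j rewrite +-cancelˡ-≡ᵇ b c j with c ≡ᵇ j
... | true  = sym (+-suc b j)
... | false = refl

cons : ∀ {n} → ℕ → Vec ℕ n × ℕ → Vec ℕ (suc n) × ℕ
cons c (v , k) = c ∷ v , k

∑-rgs-suc : ∀ n m (w : Vec ℕ (suc n) × ℕ → ℕ) →
            ∑ (rgs (suc n) m) w ≡ ∑[ c ∈ upTo (suc m) ] ∑ (rgs n (next c m)) (w ∘ cons c)
∑-rgs-suc n m w =
  trans (∑-concatMap (λ c → List.map (cons c) (rgs n (next c m))) w (upTo (suc m)))
        (∑-cong (upTo (suc m)) (λ c → ∑-map (cons c) w (rgs n (next c m))))

-- Invariant of the entries (v , k) of rgs n m: labels 0, …, m - 1 were in use before v.
record IsRGS (m : ℕ) {n} (v : Vec ℕ n) (k : ℕ) : Set where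
  field
    m≤k     : m ≤ k
    k≤m+n   : k ≤ m + n
    label<k : ∀ i → lookup v i < k
    onto    : ∀ {l} → m ≤ l → l < k → ∃[ i ] lookup v i ≡ l

open IsRGS

IsRGS-[] : ∀ m → IsRGS m [] m
IsRGS-[] m = record
  { m≤k     = ≤-refl
  ; k≤m+n   = m≤m+n m 0
  ; label<k = λ ()
  ; onto    = λ m≤l l<m → ⊥-elim (<⇒≱ l<m m≤l)
  }

IsRGS-new : ∀ m {n} {v : Vec ℕ n} {k} → IsRGS (suc m) v k → IsRGS m (m ∷ v) k
IsRGS-new m {n} {v} {k} r = record
  { m≤k     = ≤-trans (n≤1+n m) (m≤k r)
  ; k≤m+n   = subst (k ≤_) (sym (+-suc m n)) (k≤m+n r)
  ; label<k = λ { Fin.zero → m≤k r ; (Fin.suc i) → label<k r i }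
  ; onto    = onto′
  }
  where
  onto′ : ∀ {l} → m ≤ l → l < k → ∃[ i ] lookup (m ∷ v) i ≡ l
  onto′ {l} m≤l l<k with m ≟ l
  ... | yes m≡l = Fin.zero , m≡l
  ... | no  m≢l = let i , eq = onto r (≤∧≢⇒< m≤l m≢l) l<k in Fin.suc i , eq

IsRGS-old : ∀ m {n} {c} {v : Vec ℕ n} {k} → c < m → IsRGS m v k → IsRGS m (c ∷ v) k
IsRGS-old m {n} c<m r = record
  { m≤k     = m≤k r
  ; k≤m+n   = ≤-trans (k≤m+n r) (+-monoʳ-≤ m (n≤1+n n))
  ; label<k = λ { Fin.zero → <-≤-trans c<m (m≤k r) ; (Fin.suc i) → label<k r i }
  ; onto    = λ m≤l l<k → let i , eq = onto r m≤l l<k in Fin.suc i , eq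
  }

IsRGS-cons : ∀ m {n} {c} {v : Vec ℕ n} {k} →
             c < suc m → IsRGS (next c m) v k → IsRGS m (c ∷ v) k
IsRGS-cons m {c = c} c≤m r with c ≟ m
... | yes refl = IsRGS-new m (subst (λ m′ → IsRGS m′ _ _) (next-≡ m) r)
... | no  c≢m  = IsRGS-old m (≤∧≢⇒< (≤-pred c≤m) c≢m) (subst (λ m′ → IsRGS m′ _ _) (next-≢ c≢m) r)

rgs-IsRGS : ∀ n m → All (uncurry (IsRGS m)) (rgs n m)
rgs-IsRGS zero    m = IsRGS-[] m ∷ []
rgs-IsRGS (suc n) m = concat⁺ (map⁺ (applyUpTo⁺₁ id (suc m) λ {c} c<1+m →
  map⁺ (All.map (IsRGS-cons m c<1+m) (rgs-IsRGS n (next c m)))))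

IsRGS⇒0<k : ∀ {n} {v : Vec ℕ n} {k} → 0 < n → IsRGS 0 v k → 0 < k
IsRGS⇒0<k {suc n} _ r = <-≤-trans (s≤s z≤n) (label<k r Fin.zero)

∑-rgs-++ : ∀ n₁ n₂ m (w : Vec ℕ (n₁ + n₂) × ℕ → ℕ) →
           ∑ (rgs (n₁ + n₂) m) w
           ≡ ∑[ p₁ ∈ rgs n₁ m ] ∑[ p₂ ∈ rgs n₂ (proj₂ p₁) ] w (proj₁ p₁ ++ proj₁ p₂ , proj₂ p₂)
∑-rgs-++ zero     n₂ m w = sym (+-identityʳ _)
∑-rgs-++ (suc n₁) n₂ m w = begin
  ∑ (rgs (suc n₁ + n₂) m) w
    ≡⟨ ∑-rgs-suc (n₁ + n₂) m w ⟩
  ∑[ c ∈ upTo (suc m) ] ∑ (rgs (n₁ + n₂) (next c m)) (w ∘ cons c)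
    ≡⟨ ∑-cong (upTo (suc m)) (λ c → ∑-rgs-++ n₁ n₂ (next c m) (w ∘ cons c)) ⟩
  ∑[ c ∈ upTo (suc m) ] ∑ (rgs n₁ (next c m)) (F ∘ cons c)
    ≡⟨ ∑-rgs-suc n₁ m F ⟨
  ∑ (rgs (suc n₁) m) F ∎
  where
  open ≡-Reasoning
  F : Vec ℕ (suc n₁) × ℕ → ℕ
  F (v₁ , k₁) = ∑[ p₂ ∈ rgs n₂ k₁ ] w (v₁ ++ proj₁ p₂ , proj₂ p₂)

shift : ∀ {n} → ℕ → Vec ℕ n × ℕ → Vec ℕ n × ℕ
shift b (v , k) = Vec.map (b +_) v , b + k

allAtLeast : ∀ {n} → ℕ → Vec ℕ n → Bool
allAtLeast b v = does (VecAll.all? (b ≤?_) v)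

∑-rgs-shift : ∀ n b j (F : Vec ℕ n × ℕ → ℕ) →
              ∑[ p ∈ rgs n (b + j) ] 𝟙 (allAtLeast b (proj₁ p)) * F p
              ≡ ∑[ p ∈ rgs n j ] F (shift b p)
∑-rgs-shift zero    b j F = cong (_+ 0) (*-identityˡ _)
∑-rgs-shift (suc n) b j F = begin
  ∑ (rgs (suc n) (b + j)) W
    ≡⟨ ∑-rgs-suc n (b + j) W ⟩
  ∑ (upTo (suc (b + j))) H
    ≡⟨ cong (λ m → ∑ (upTo m) H) (+-suc b j) ⟨
  ∑ (upTo (b + suc j)) H
    ≡⟨ ∑-upTo-+ b (suc j) H ⟩
  ∑ (upTo b) H + ∑[ c ∈ upTo (suc j) ] H (b + c)
    ≡⟨ cong₂ _+_ (∑-zero (applyUpTo⁺₁ id b H-low)) (∑-cong (upTo (suc j)) H-high) ⟩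
  ∑[ c ∈ upTo (suc j) ] ∑ (rgs n (next c j)) (R ∘ cons c)
    ≡⟨ ∑-rgs-suc n j R ⟨
  ∑ (rgs (suc n) j) R ∎
  where
  open ≡-Reasoning
  W R : Vec ℕ (suc n) × ℕ → ℕ
  W p = 𝟙 (allAtLeast b (proj₁ p)) * F p
  R   = F ∘ shift b
  H : ℕ → ℕ
  H c = ∑ (rgs n (next c (b + j))) (W ∘ cons c)
  H-low : ∀ {c} → c < b → H c ≡ 0
  H-low {c} c<b = ∑-zero (All.universal (λ p →
    cong (λ t → 𝟙 (t ∧ allAtLeast b (proj₁ p)) * F (cons c p)) (dec-false (b ≤? c) (<⇒≱ c<b)))
    (rgs n (next c (b + j))))
  H-high : ∀ c → H (b + c) ≡ ∑ (rgs n (next c j)) (R ∘ cons c)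
  H-high c = begin
    ∑ (rgs n (next (b + c) (b + j))) (W ∘ cons (b + c))
      ≡⟨ cong (λ m → ∑ (rgs n m) (W ∘ cons (b + c))) (next-+ b c j) ⟩
    ∑ (rgs n (b + next c j)) (W ∘ cons (b + c))
      ≡⟨ ∑-cong (rgs n (b + next c j)) (λ p →
           cong (λ t → 𝟙 (t ∧ allAtLeast b (proj₁ p)) * F (cons (b + c) p))
                (dec-true (b ≤? b + c) (m≤m+n b c))) ⟩
    ∑[ p ∈ rgs n (b + next c j) ] 𝟙 (allAtLeast b (proj₁ p)) * F (cons (b + c) p)
      ≡⟨ ∑-rgs-shift n b (next c j) (F ∘ cons (b + c)) ⟩
    ∑ (rgs n (next c j)) (R ∘ cons c) ∎

discrete : ∀ n → ℕ → Vec ℕ n × ℕ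
discrete zero    m = [] , m
discrete (suc n) m = cons m (discrete n (suc m))

discrete-∈-rgs : ∀ n m → discrete n m ∈ rgs n m
discrete-∈-rgs zero    m = here refl
discrete-∈-rgs (suc n) m = ∈-concatMap⁺ (λ c → List.map (cons c) (rgs n (next c m)))
  (Any.map (λ { refl → ∈-map⁺ (cons m) m∈ }) (∈-upTo⁺ ≤-refl))
  where
  m∈ : discrete n (suc m) ∈ rgs n (next m m)
  m∈ = subst (λ m′ → discrete n (suc m) ∈ rgs n m′) (sym (next-≡ m)) (discrete-∈-rgs n (suc m))

lookup-discrete : ∀ n m (i : Fin n) → lookup (proj₁ (discrete n m)) i ≡ m + toℕ i
lookup-discrete (suc n) m Fin.zero    = sym (+-identityʳ m)
lookup-discrete (suc n) m (Fin.suc i) =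
  trans (lookup-discrete n (suc m) i) (sym (+-suc m (toℕ i)))

-- Proper colourings

Proper : (G : Graph) → Vec ℕ (n G) → Set
Proper G v = ∀ i j → T (adj G i j) → lookup v i ≢ lookup v j

isProper⇔Proper : ∀ G v → T (isProper G v) ⇔ Proper G v
isProper⇔Proper G v = mk⇔ sound complete
  where
  edge : Fin (n G) → Fin (n G) → Bool
  edge i j = not (adj G i j) ∨ not (lookup v i ≡ᵇ lookup v j)
  edges : List Bool
  edges = concatMap (λ i → List.map (edge i) (allFin (n G))) (allFin (n G))
  edge⇔ : ∀ i j → T (edge i j) ⇔ (T (adj G i j) → lookup v i ≢ lookup v j)
  edge⇔ i j = mk⇔
    (λ t a eq → to (T-not∨not (adj G i j) _) t a (≡⇒≡ᵇ _ _ eq))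
    (λ h → from (T-not∨not (adj G i j) _) (λ a t → h a (≡ᵇ⇒≡ _ _ t)))
  sound : T (isProper G v) → Proper G v
  sound t i j = to (edge⇔ i j)
    (All.lookup (map⁻ (All.lookup (map⁻ (concat⁻ (to (T-and edges) t))) (∈-allFin i))) (∈-allFin j))
  complete : Proper G v → T (isProper G v)
  complete p = from (T-and edges) (concat⁺ (map⁺ (All.universal
    (λ i → map⁺ (All.universal (λ j → from (edge⇔ i j) (p i j)) (allFin (n G)))) (allFin (n G)))))

isProper-cong : ∀ G (u v : Vec ℕ (n G)) →
                (∀ i j → (lookup u i ≡ᵇ lookup u j) ≡ (lookup v i ≡ᵇ lookup v j)) →
                isProper G u ≡ isProper G v
isProper-cong G u v eq = cong and (concatMap-cong
  (λ i → map-cong (λ j → cong (λ b → not (adj G i j) ∨ not b) (eq i j)) (allFin _)) (allFin _))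

isProper-shift : ∀ G b (u : Vec ℕ (n G)) → isProper G (Vec.map (b +_) u) ≡ isProper G u
isProper-shift G b u = isProper-cong G (Vec.map (b +_) u) u λ i j →
  trans (cong₂ _≡ᵇ_ (lookup-map i (b +_) u) (lookup-map j (b +_) u)) (+-cancelˡ-≡ᵇ b _ _)

discrete-isProper : ∀ G → isProper G (proj₁ (discrete (n G) 0)) ≡ true
discrete-isProper G = to T-≡ (from (isProper⇔Proper G (proj₁ (discrete (n G) 0))) proper)
  where
  proper : Proper G (proj₁ (discrete (n G) 0))
  proper i j a eq
    with toℕ-injective (trans (sym (lookup-discrete _ 0 i)) (trans eq (lookup-discrete _ 0 j)))
  ... | refl = subst T (irrefl G i) a

module _ {n₁ n₂} (a₁ : Fin n₁ → Fin n₁ → Bool) (a₂ : Fin n₂ → Fin n₂ → Bool) where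

  joinAdj-↑ˡ-↑ˡ : ∀ i j → joinAdj a₁ a₂ (i ↑ˡ n₂) (j ↑ˡ n₂) ≡ a₁ i j
  joinAdj-↑ˡ-↑ˡ i j rewrite splitAt-↑ˡ n₁ i n₂ | splitAt-↑ˡ n₁ j n₂ = refl

  joinAdj-↑ʳ-↑ʳ : ∀ i j → joinAdj a₁ a₂ (n₁ ↑ʳ i) (n₁ ↑ʳ j) ≡ a₂ i j
  joinAdj-↑ʳ-↑ʳ i j rewrite splitAt-↑ʳ n₁ n₂ i | splitAt-↑ʳ n₁ n₂ j = refl

  joinAdj-↑ˡ-↑ʳ : ∀ i j → joinAdj a₁ a₂ (i ↑ˡ n₂) (n₁ ↑ʳ j) ≡ true
  joinAdj-↑ˡ-↑ʳ i j rewrite splitAt-↑ˡ n₁ i n₂ | splitAt-↑ʳ n₁ n₂ j = refl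

module _ (G₁ G₂ : Graph) (v₁ : Vec ℕ (n G₁)) {k₁} (v₂ : Vec ℕ (n G₂))
         (label<k₁ : ∀ i → lookup v₁ i < k₁)
         (onto : ∀ {l} → l < k₁ → ∃[ i ] lookup v₁ i ≡ l) where

  private
    a₁ = adj G₁
    a₂ = adj G₂

  Proper-⊕⁻ : Proper (G₁ ⊕ G₂) (v₁ ++ v₂) →
              Proper G₁ v₁ × VecAll.All (k₁ ≤_) v₂ × Proper G₂ v₂
  Proper-⊕⁻ p = proper₁ , lookup⁻ above , proper₂
    where
    proper₁ : Proper G₁ v₁
    proper₁ i j a eq = p (i ↑ˡ _) (j ↑ˡ _) (subst T (sym (joinAdj-↑ˡ-↑ˡ a₁ a₂ i j)) a)
      (trans (lookup-++ˡ v₁ v₂ i) (trans eq (sym (lookup-++ˡ v₁ v₂ j))))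
    proper₂ : Proper G₂ v₂
    proper₂ i j a eq = p (_ ↑ʳ i) (_ ↑ʳ j) (subst T (sym (joinAdj-↑ʳ-↑ʳ a₁ a₂ i j)) a)
      (trans (lookup-++ʳ v₁ v₂ i) (trans eq (sym (lookup-++ʳ v₁ v₂ j))))
    above : ∀ j → k₁ ≤ lookup v₂ j
    above j with lookup v₂ j <? k₁
    ... | no  ≮k₁ = ≮⇒≥ ≮k₁
    ... | yes <k₁ = let i , eq = onto <k₁ in
      ⊥-elim (p (i ↑ˡ _) (_ ↑ʳ j) (subst T (sym (joinAdj-↑ˡ-↑ʳ a₁ a₂ i j)) _)
                (trans (lookup-++ˡ v₁ v₂ i) (trans eq (sym (lookup-++ʳ v₁ v₂ j)))))

  Proper-⊕⁺ : Proper G₁ v₁ → VecAll.All (k₁ ≤_) v₂ → Proper G₂ v₂ →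
              Proper (G₁ ⊕ G₂) (v₁ ++ v₂)
  Proper-⊕⁺ p₁ above p₂ i j a eq
    rewrite lookup-splitAt (n G₁) v₁ v₂ i | lookup-splitAt (n G₁) v₁ v₂ j
    with splitAt (n G₁) i | splitAt (n G₁) j
  ... | inj₁ x | inj₁ y = p₁ x y a eq
  ... | inj₂ x | inj₂ y = p₂ x y a eq
  ... | inj₁ x | inj₂ y = <⇒≢ (<-≤-trans (label<k₁ x) (lookup⁺ above y)) eq
  ... | inj₂ x | inj₁ y = <⇒≢ (<-≤-trans (label<k₁ y) (lookup⁺ above x)) (sym eq)

  isProper-⊕ : isProper (G₁ ⊕ G₂) (v₁ ++ v₂)
               ≡ isProper G₁ v₁ ∧ (allAtLeast k₁ v₂ ∧ isProper G₂ v₂)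
  isProper-⊕ = does-⇔ (mk⇔ split merge) (T? _) (T? _ ×-dec VecAll.all? (k₁ ≤?_) v₂ ×-dec T? _)
    where
    P⇔ : ∀ G v → T (isProper G v) ⇔ Proper G v
    P⇔ = isProper⇔Proper
    split : T (isProper (G₁ ⊕ G₂) (v₁ ++ v₂)) →
            T (isProper G₁ v₁) × VecAll.All (k₁ ≤_) v₂ × T (isProper G₂ v₂)
    split t = let p₁ , above , p₂ = Proper-⊕⁻ (to (P⇔ (G₁ ⊕ G₂) (v₁ ++ v₂)) t) in
      from (P⇔ G₁ v₁) p₁ , above , from (P⇔ G₂ v₂) p₂
    merge : T (isProper G₁ v₁) × VecAll.All (k₁ ≤_) v₂ × T (isProper G₂ v₂) →
            T (isProper (G₁ ⊕ G₂) (v₁ ++ v₂))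
    merge (t₁ , above , t₂) =
      from (P⇔ (G₁ ⊕ G₂) (v₁ ++ v₂)) (Proper-⊕⁺ (to (P⇔ G₁ v₁) t₁) above (to (P⇔ G₂ v₂) t₂))

-- Sums over colourings

χ : (G : Graph) → Vec ℕ (n G) × ℕ → ℕ
χ G p = 𝟙 (isProper G (proj₁ p))

coloringSum : Graph → (ℕ → ℕ) → ℕ
coloringSum G h = ∑[ p ∈ partitions (n G) ] χ G p * h (proj₂ p)

sumTo-S : ∀ G (h : ℕ → ℕ) → sumTo (n G) (λ k → h k * S G k) ≡ coloringSum G h
sumTo-S G h = begin
  sumTo N (λ k → h k * S G k)
    ≡⟨ sumTo-cong N S-as-∑ ⟩
  sumTo N (λ k → ∑[ p ∈ L ] h k * (χ G p * 𝟙 (proj₂ p ≡ᵇ k)))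
    ≡⟨ sumTo-∑ N _ L ⟩
  ∑[ p ∈ L ] sumTo N (λ k → h k * (χ G p * 𝟙 (proj₂ p ≡ᵇ k)))
    ≡⟨ ∑-congᴬ (All.map pick-k (rgs-IsRGS N 0)) ⟩
  coloringSum G h ∎
  where
  open ≡-Reasoning
  N = n G
  L = partitions N
  S-as-∑ : ∀ k → h k * S G k ≡ ∑[ p ∈ L ] h k * (χ G p * 𝟙 (proj₂ p ≡ᵇ k))
  S-as-∑ k = trans (cong (h k *_) (trans (length-filterᵇ _ L) (∑-cong L (λ p → 𝟙-∧ (isProper G (proj₁ p)) _))))
                   (sym (∑-*ˡ (h k) _ L))
  pick-k : ∀ {p} → uncurry (IsRGS 0) p →
           sumTo N (λ k → h k * (χ G p * 𝟙 (proj₂ p ≡ᵇ k))) ≡ χ G p * h (proj₂ p)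
  pick-k {p} r = begin
    sumTo N (λ k → h k * (χ G p * 𝟙 (proj₂ p ≡ᵇ k)))
      ≡⟨ sumTo-cong N (λ k → *-rotate (h k) (χ G p) _) ⟩
    sumTo N (λ k → χ G p * (𝟙 (proj₂ p ≡ᵇ k) * h k))
      ≡⟨ sumTo-*ˡ (χ G p) N _ ⟩
    χ G p * sumTo N (λ k → 𝟙 (proj₂ p ≡ᵇ k) * h k)
      ≡⟨ cong (χ G p *_) (sumTo-𝟙≡ᵇ N h (IsRGS⇒0<k (nonempty G) r) (k≤m+n r)) ⟩
    χ G p * h (proj₂ p) ∎

𝓑≡coloringSum : ∀ G → 𝓑 G ≡ coloringSum G (λ _ → 1)
𝓑≡coloringSum G =
  trans (sumTo-cong (n G) (λ k → sym (*-identityˡ (S G k)))) (sumTo-S G (λ _ → 1))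

𝓣≡coloringSum : ∀ G → 𝓣 G ≡ coloringSum G id
𝓣≡coloringSum G = sumTo-S G id

𝓑-pos : ∀ G → 0 < 𝓑 G
𝓑-pos G = subst (0 <_) (sym (𝓑≡coloringSum G))
  (≤-trans (≤-reflexive (cong (λ b → 𝟙 b * 1) (sym (discrete-isProper G))))
           (∈⇒≤∑ (λ p → χ G p * 1) (discrete-∈-rgs (n G) 0)))

coloringSum-⊕ : ∀ G₁ G₂ (h : ℕ → ℕ) →
  coloringSum (G₁ ⊕ G₂) h
  ≡ ∑[ p₁ ∈ partitions (n G₁) ] χ G₁ p₁ * (∑[ p₂ ∈ partitions (n G₂) ] χ G₂ p₂ * h (proj₂ p₁ + proj₂ p₂))
coloringSum-⊕ G₁ G₂ h =
  trans (∑-rgs-++ (n G₁) (n G₂) 0 _) (∑-congᴬ (All.map (λ {p₁} → inner p₁) (rgs-IsRGS (n G₁) 0)))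
  where
  open ≡-Reasoning
  F : Vec ℕ (n G₂) × ℕ → ℕ
  F p = χ G₂ p * h (proj₂ p)
  inner : ∀ p₁ → uncurry (IsRGS 0) p₁ →
          ∑[ p₂ ∈ rgs (n G₂) (proj₂ p₁) ] χ (G₁ ⊕ G₂) (proj₁ p₁ ++ proj₁ p₂ , proj₂ p₂) * h (proj₂ p₂)
          ≡ χ G₁ p₁ * (∑[ p₂ ∈ partitions (n G₂) ] χ G₂ p₂ * h (proj₂ p₁ + proj₂ p₂))
  inner p₁@(v₁ , k₁) r = begin
    ∑[ p₂ ∈ rgs (n G₂) k₁ ] χ (G₁ ⊕ G₂) (v₁ ++ proj₁ p₂ , proj₂ p₂) * h (proj₂ p₂)
      ≡⟨ ∑-cong (rgs (n G₂) k₁) factor ⟩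
    ∑[ p₂ ∈ rgs (n G₂) k₁ ] χ G₁ p₁ * (𝟙 (allAtLeast k₁ (proj₁ p₂)) * F p₂)
      ≡⟨ ∑-*ˡ (χ G₁ p₁) _ (rgs (n G₂) k₁) ⟩
    χ G₁ p₁ * (∑[ p₂ ∈ rgs (n G₂) k₁ ] 𝟙 (allAtLeast k₁ (proj₁ p₂)) * F p₂)
      ≡⟨ cong (λ m → χ G₁ p₁ * (∑[ p₂ ∈ rgs (n G₂) m ] 𝟙 (allAtLeast k₁ (proj₁ p₂)) * F p₂))
              (+-identityʳ k₁) ⟨
    χ G₁ p₁ * (∑[ p₂ ∈ rgs (n G₂) (k₁ + 0) ] 𝟙 (allAtLeast k₁ (proj₁ p₂)) * F p₂)
      ≡⟨ cong (χ G₁ p₁ *_) (∑-rgs-shift (n G₂) k₁ 0 F) ⟩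
    χ G₁ p₁ * (∑[ p₂ ∈ partitions (n G₂) ] F (shift k₁ p₂))
      ≡⟨ cong (χ G₁ p₁ *_) (∑-cong (partitions (n G₂)) (λ p₂ →
           cong (λ b → 𝟙 b * h (k₁ + proj₂ p₂)) (isProper-shift G₂ k₁ (proj₁ p₂)))) ⟩
    χ G₁ p₁ * (∑[ p₂ ∈ partitions (n G₂) ] χ G₂ p₂ * h (k₁ + proj₂ p₂)) ∎
    where
    factor : ∀ p₂ → χ (G₁ ⊕ G₂) (v₁ ++ proj₁ p₂ , proj₂ p₂) * h (proj₂ p₂)
                    ≡ χ G₁ p₁ * (𝟙 (allAtLeast k₁ (proj₁ p₂)) * F p₂)
    factor p₂@(v₂ , k₂) = begin
      𝟙 (isProper (G₁ ⊕ G₂) (v₁ ++ v₂)) * h k₂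
        ≡⟨ cong (λ b → 𝟙 b * h k₂) (isProper-⊕ G₁ G₂ v₁ v₂ (label<k r) (onto r z≤n)) ⟩
      𝟙 (isProper G₁ v₁ ∧ (allAtLeast k₁ v₂ ∧ isProper G₂ v₂)) * h k₂
        ≡⟨ cong (_* h k₂) (trans (𝟙-∧ (isProper G₁ v₁) _) (cong (χ G₁ p₁ *_) (𝟙-∧ (allAtLeast k₁ v₂) _))) ⟩
      χ G₁ p₁ * (𝟙 (allAtLeast k₁ v₂) * χ G₂ p₂) * h k₂
        ≡⟨ trans (*-assoc (χ G₁ p₁) _ (h k₂)) (cong (χ G₁ p₁ *_) (*-assoc (𝟙 (allAtLeast k₁ v₂)) _ (h k₂))) ⟩
      χ G₁ p₁ * (𝟙 (allAtLeast k₁ v₂) * F p₂) ∎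

𝓑-⊕ : ∀ G₁ G₂ → 𝓑 (G₁ ⊕ G₂) ≡ 𝓑 G₁ * 𝓑 G₂
𝓑-⊕ G₁ G₂ = begin
  𝓑 (G₁ ⊕ G₂)                      ≡⟨ 𝓑≡coloringSum (G₁ ⊕ G₂) ⟩
  coloringSum (G₁ ⊕ G₂) (λ _ → 1)  ≡⟨ coloringSum-⊕ G₁ G₂ (λ _ → 1) ⟩
  ∑[ p₁ ∈ L₁ ] χ G₁ p₁ * B₂        ≡⟨ ∑-*ʳ B₂ (χ G₁) L₁ ⟩
  ∑ L₁ (χ G₁) * B₂                 ≡⟨ cong (_* B₂) (∑-cong L₁ (λ p₁ → *-identityʳ (χ G₁ p₁))) ⟨
  coloringSum G₁ (λ _ → 1) * B₂    ≡⟨ cong₂ _*_ (𝓑≡coloringSum G₁) (𝓑≡coloringSum G₂) ⟨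
  𝓑 G₁ * 𝓑 G₂                      ∎
  where
  open ≡-Reasoning
  L₁ = partitions (n G₁)
  B₂ = coloringSum G₂ (λ _ → 1)

𝓣-⊕ : ∀ G₁ G₂ → 𝓣 (G₁ ⊕ G₂) ≡ 𝓣 G₁ * 𝓑 G₂ + 𝓑 G₁ * 𝓣 G₂
𝓣-⊕ G₁ G₂ = begin
  𝓣 (G₁ ⊕ G₂)
    ≡⟨ 𝓣≡coloringSum (G₁ ⊕ G₂) ⟩
  coloringSum (G₁ ⊕ G₂) id
    ≡⟨ coloringSum-⊕ G₁ G₂ id ⟩
  ∑[ p₁ ∈ L₁ ] χ G₁ p₁ * (∑[ p₂ ∈ L₂ ] χ G₂ p₂ * (proj₂ p₁ + proj₂ p₂))
    ≡⟨ ∑-cong L₁ (λ p₁ → cong (χ G₁ p₁ *_) (inner (proj₂ p₁))) ⟩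
  ∑[ p₁ ∈ L₁ ] χ G₁ p₁ * (proj₂ p₁ * B₂ + T₂)
    ≡⟨ ∑-cong L₁ (λ p₁ → trans (*-distribˡ-+ (χ G₁ p₁) _ T₂)
                               (cong (_+ χ G₁ p₁ * T₂) (sym (*-assoc (χ G₁ p₁) _ B₂)))) ⟩
  ∑[ p₁ ∈ L₁ ] (χ G₁ p₁ * proj₂ p₁ * B₂ + χ G₁ p₁ * T₂)
    ≡⟨ ∑-+ _ _ L₁ ⟩
  ∑[ p₁ ∈ L₁ ] χ G₁ p₁ * proj₂ p₁ * B₂ + ∑[ p₁ ∈ L₁ ] χ G₁ p₁ * T₂
    ≡⟨ cong₂ _+_ (∑-*ʳ B₂ (λ p₁ → χ G₁ p₁ * proj₂ p₁) L₁) (∑-*ʳ T₂ (χ G₁) L₁) ⟩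
  coloringSum G₁ id * B₂ + ∑ L₁ (χ G₁) * T₂
    ≡⟨ cong (λ B₁ → coloringSum G₁ id * B₂ + B₁ * T₂) (∑-cong L₁ (λ p₁ → *-identityʳ (χ G₁ p₁))) ⟨
  coloringSum G₁ id * B₂ + coloringSum G₁ (λ _ → 1) * T₂
    ≡⟨ cong₂ _+_ (cong₂ _*_ (𝓣≡coloringSum G₁) (𝓑≡coloringSum G₂))
                 (cong₂ _*_ (𝓑≡coloringSum G₁) (𝓣≡coloringSum G₂)) ⟨
  𝓣 G₁ * 𝓑 G₂ + 𝓑 G₁ * 𝓣 G₂ ∎
  where
  open ≡-Reasoning
  L₁ = partitions (n G₁)
  L₂ = partitions (n G₂)
  B₂ = coloringSum G₂ (λ _ → 1)
  T₂ = coloringSum G₂ id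
  inner : ∀ k₁ → ∑[ p₂ ∈ L₂ ] χ G₂ p₂ * (k₁ + proj₂ p₂) ≡ k₁ * B₂ + T₂
  inner k₁ = begin
    ∑[ p₂ ∈ L₂ ] χ G₂ p₂ * (k₁ + proj₂ p₂)
      ≡⟨ ∑-cong L₂ (λ p₂ → *-distribˡ-+ (χ G₂ p₂) k₁ _) ⟩
    ∑[ p₂ ∈ L₂ ] (χ G₂ p₂ * k₁ + χ G₂ p₂ * proj₂ p₂)
      ≡⟨ ∑-+ _ _ L₂ ⟩
    ∑[ p₂ ∈ L₂ ] χ G₂ p₂ * k₁ + T₂
      ≡⟨ cong (_+ T₂) (∑-cong L₂ (λ p₂ → trans (*-comm (χ G₂ p₂) k₁) (cong (k₁ *_) (sym (*-identityʳ _))))) ⟩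
    ∑[ p₂ ∈ L₂ ] k₁ * (χ G₂ p₂ * 1) + T₂
      ≡⟨ cong (_+ T₂) (∑-*ˡ k₁ _ L₂) ⟩
    k₁ * B₂ + T₂ ∎

-- Computed through unnormalised rationals, whose addition does not normalise.
ratio-+ : ∀ t₁ t₂ {b₁ b₂} → 0 < b₁ → 0 < b₂ →
          ratio (t₁ * b₂ + b₁ * t₂) (b₁ * b₂) ≡ ratio t₁ b₁ ℚ.+ ratio t₂ b₂
ratio-+ t₁ t₂ {suc b₁} {suc b₂} _ _ = sym (begin
  r₁ ℚ.+ r₂
    ≡⟨ fromℚᵘ-toℚᵘ (r₁ ℚ.+ r₂) ⟨
  fromℚᵘ (toℚᵘ (r₁ ℚ.+ r₂))
    ≡⟨ fromℚᵘ-cong (ℚᵘ.≃-trans (toℚᵘ-homo-+ r₁ r₂) (ℚᵘ.+-cong (toℚᵘ-fromℚᵘ q₁) (toℚᵘ-fromℚᵘ q₂))) ⟩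
  fromℚᵘ (q₁ ℚᵘ.+ q₂)
    ≡⟨ /-cong numerator refl ⟩
  ratio (t₁ * suc b₂ + suc b₁ * t₂) (suc b₁ * suc b₂) ∎)
  where
  open ≡-Reasoning
  q₁ = mkℚᵘ (ℤ.+ t₁) b₁
  q₂ = mkℚᵘ (ℤ.+ t₂) b₂
  r₁ = fromℚᵘ q₁
  r₂ = fromℚᵘ q₂
  numerator : ℤ.+ t₁ ℤ.* ℤ.+ suc b₂ ℤ.+ ℤ.+ t₂ ℤ.* ℤ.+ suc b₁ ≡ ℤ.+ (t₁ * suc b₂ + suc b₁ * t₂)
  numerator = begin
    ℤ.+ t₁ ℤ.* ℤ.+ suc b₂ ℤ.+ ℤ.+ t₂ ℤ.* ℤ.+ suc b₁
      ≡⟨ cong₂ ℤ._+_ (pos-* t₁ (suc b₂)) (pos-* t₂ (suc b₁)) ⟨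
    ℤ.+ (t₁ * suc b₂) ℤ.+ ℤ.+ (t₂ * suc b₁)
      ≡⟨ pos-+ (t₁ * suc b₂) (t₂ * suc b₁) ⟨
    ℤ.+ (t₁ * suc b₂ + t₂ * suc b₁)
      ≡⟨ cong (λ x → ℤ.+ (t₁ * suc b₂ + x)) (*-comm t₂ (suc b₁)) ⟩
    ℤ.+ (t₁ * suc b₂ + suc b₁ * t₂) ∎

theorem1 : (G₁ G₂ : Graph) → 𝓐 (G₁ ⊕ G₂) ≡ 𝓐 G₁ ℚ.+ 𝓐 G₂
theorem1 G₁ G₂ = trans (cong₂ ratio (𝓣-⊕ G₁ G₂) (𝓑-⊕ G₁ G₂))
                       (ratio-+ (𝓣 G₁) (𝓣 G₂) (𝓑-pos G₁) (𝓑-pos G₂))
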